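{- Let $(\rho^{\mathsf v},\rho^{\mathsf c},\chi)$ be a separated abstract higher-order GSOS law and let $\xi$ be the induced big-step transformation (as defined in the context). Then $T\mu^\Sigma_0\circ\xi_{\mu\Sigma}=T\nabla^\sharp\circ\rho^{\mathsf{cv}}_{\mu\Sigma,\mu\Sigma}\circ\Sigma_{\mathsf c}(\langle\iota^{\mathsf v},\gamma^{\mathsf v}\rangle,\mathrm{id})$ as morphisms $\Sigma_{\mathsf c}(S_{\mathsf v},\mu\Sigma)\to T\mu\Sigma$.
   Context: Conventions: $\mathcal C$ is a distributive category; $\mathrm{inl},\mathrm{inr}$, $[f,g]$, $\langle f,g\rangle$, $\mathrm{fst},\mathrm{snd}$, $\nabla=[\mathrm{id},\mathrm{id}]$ as usual. Syntax: functors $\Sigma_{\mathsf v}\colon\mathcal C\to\mathcal C$, $\Sigma_{\mathsf c}\colon\mathcal C\times\mathcal C\to\mathcal C$, $\Sigma X=\Sigma_{\mathsf v}X+\Sigma_{\mathsf c}(X,X)$; free $\Sigma$-algebras exist; $(\Sigma^\star,\eta^\Sigma,\mu^\Sigma)$ is the free monad with algebra structures $\iota_X\colon\Sigma\Sigma^\star X\to\Sigma^\star X$, $\iota^{\mathsf v}=\iota\circ\mathrm{inl}\colon\Sigma_{\mathsf v}\Sigma^\star X\to\Sigma^\star X$. $\mu\Sigma=\Sigma^\star0$, $S_{\mathsf v}=\Sigma_{\mathsf v}\mu\Sigma$, $S_{\mathsf c}=\Sigma_{\mathsf c}(\mu\Sigma,\mu\Sigma)$. For every $X$, $\nabla^\sharp=\mu^\Sigma_X\circ\Sigma^\star\nabla\colon\Sigma^\star(\Sigma^\star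 X+\Sigma^\star X)\to\Sigma^\star X$ (for $X=0$: $\Sigma^\star(\mu\Sigma+\mu\Sigma)\to\mu\Sigma$); $\mu^\Sigma_0\colon\Sigma^\star\mu\Sigma\to\mu\Sigma$. Behaviour: $T$ a strong monad with unit $\eta^T$, multiplication $m^T$; $D\colon\mathcal C^{op}\times\mathcal C\to\mathcal C$ a functor; $B(X,Y)=TD(X,Y)+TY$. A separated abstract higher-order GSOS law is a triple $(\rho^{\mathsf v},\rho^{\mathsf c},\chi)$: $\rho^{\mathsf v}_X\colon\Sigma_{\mathsf v}X\to D(X,\Sigma^\star X)$ dinatural in $X$; $\rho^{\mathsf c}_{X,Y}\colon\Sigma_{\mathsf c}(X\times B(X,Y),X)\to T\Sigma^\star(X+Y)$ dinatural in $X$, natural in $Y$; $\chi_{X,Y}\colon\Sigma_{\mathsf c}(TX,Y)\to T\Sigma_{\mathsf c}(X,Y)$ natural, and for each $Y$ a distributive law of $T$ over $\Sigma_{\mathsf c}(-,Y)$. $\rho^{\mathsf{cv}}_{X,Y}=\rho^{\mathsf c}_{X,Y}\circ\Sigma_{\mathsf c}(\mathrm{id}\times\mathrm{inl},\mathrm{id})\colon\Sigma_{\mathsf c}(X\times TD(X,Y),X)\to T\Sigma^\star(X+Y)$. $\gamma^{\mathsf v}=\eta^T\circ D(\mathrm{id},\mu^\Sigma_0)\circ\rho^{\mathsf v}_{\mu\Sigma}\colon S_{\mathsf v}\to TD(\mu\Sigma,\mu\Sigma)$. Big-step transformation: $\xi_X=T\nabla^\sharp\circ\rho^{\mathsf{cv}}_{\Sigma^\star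 X,\Sigma^\star X}\circ\Sigma_{\mathsf c}(\langle\iota^{\mathsf v},\eta^T\circ D(\mathrm{id},\mu^\Sigma_X)\circ\rho^{\mathsf v}_{\Sigma^\star X}\rangle,\mathrm{id})\circ\Sigma_{\mathsf c}(\Sigma_{\mathsf v}\eta^\Sigma_X,\eta^\Sigma_X)\colon\Sigma_{\mathsf c}(\Sigma_{\mathsf v}X,X)\to T\Sigma^\star X$. -}

module Defs where

open import Level using (Level; _⊔_) renaming (suc to lsuc)
open import Relation.Binary using (IsEquivalence)

record Category (o ℓ e : Level) : Set (lsuc (o ⊔ ℓ ⊔ e)) where
  infix  4 _≈_ _⇒_
  infixr 9 _∘_
  field
    Obj : Set o
    _⇒_ : Obj → Obj → Set ℓ
    _≈_ : ∀ {A B} → (A ⇒ B) → (A ⇒ B) → Set e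
    id  : ∀ {A} → A ⇒ A
    _∘_ : ∀ {A B C} → B ⇒ C → A ⇒ B → A ⇒ C
    equiv     : ∀ {A B} → IsEquivalence (_≈_ {A} {B})
    ∘-resp-≈  : ∀ {A B C} {f h : B ⇒ C} {g i : A ⇒ B} → f ≈ h → g ≈ i → f ∘ g ≈ h ∘ i
    identityˡ : ∀ {A B} {f : A ⇒ B} → id ∘ f ≈ f
    identityʳ : ∀ {A B} {f : A ⇒ B} → f ∘ id ≈ f
    assoc     : ∀ {A B C D} {f : A ⇒ B} {g : B ⇒ C} {h : C ⇒ D} → (h ∘ g) ∘ f ≈ h ∘ (g ∘ f)

record Distributive {o ℓ e} (C : Category o ℓ e) : Set (o ⊔ ℓ ⊔ e) where
  open Category C
  infixr 7 _×_
  infixr 6 _+_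
  field
    𝟘 : Obj
    ¡ : ∀ {A} → 𝟘 ⇒ A
    ¡-unique : ∀ {A} (f : 𝟘 ⇒ A) → f ≈ ¡
    𝟙 : Obj
    ! : ∀ {A} → A ⇒ 𝟙
    !-unique : ∀ {A} (f : A ⇒ 𝟙) → f ≈ !
    _×_ : Obj → Obj → Obj
    fst : ∀ {A B} → A × B ⇒ A
    snd : ∀ {A B} → A × B ⇒ B
    ⟨_,_⟩ : ∀ {X A B} → X ⇒ A → X ⇒ B → X ⇒ A × B
    fst∘⟨⟩ : ∀ {X A B} {f : X ⇒ A} {g : X ⇒ B} → fst ∘ ⟨ f , g ⟩ ≈ f
    snd∘⟨⟩ : ∀ {X A B} {f : X ⇒ A} {g : X ⇒ B} → snd ∘ ⟨ f , g ⟩ ≈ g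
    ⟨⟩-unique : ∀ {X A B} {f : X ⇒ A} {g : X ⇒ B} {h : X ⇒ A × B} →
                fst ∘ h ≈ f → snd ∘ h ≈ g → h ≈ ⟨ f , g ⟩
    _+_ : Obj → Obj → Obj
    inl : ∀ {A B} → A ⇒ A + B
    inr : ∀ {A B} → B ⇒ A + B
    [_,_] : ∀ {A B X} → A ⇒ X → B ⇒ X → A + B ⇒ X
    []∘inl : ∀ {A B X} {f : A ⇒ X} {g : B ⇒ X} → [ f , g ] ∘ inl ≈ f
    []∘inr : ∀ {A B X} {f : A ⇒ X} {g : B ⇒ X} → [ f , g ] ∘ inr ≈ g
    []-unique : ∀ {A B X} {f : A ⇒ X} {g : B ⇒ X} {h : A + B ⇒ X} →
                h ∘ inl ≈ f → h ∘ inr ≈ g → h ≈ [ f , g ]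
    distˡ⁻¹ : ∀ {A B C} → A × (B + C) ⇒ (A × B) + (A × C)
    distˡ-iso₁ : ∀ {A B C} →
      distˡ⁻¹ ∘ [ ⟨ fst , inl ∘ snd ⟩ , ⟨ fst , inr ∘ snd ⟩ ] ≈ id {(A × B) + (A × C)}
    distˡ-iso₂ : ∀ {A B C} →
      [ ⟨ fst , inl ∘ snd ⟩ , ⟨ fst , inr ∘ snd ⟩ ] ∘ distˡ⁻¹ ≈ id {A × (B + C)}

  infixr 7 _×₁_
  infixr 6 _+₁_
  _×₁_ : ∀ {A B A' B'} → A ⇒ A' → B ⇒ B' → A × B ⇒ A' × B'
  f ×₁ g = ⟨ f ∘ fst , g ∘ snd ⟩

  _+₁_ : ∀ {A B A' B'} → A ⇒ A' → B ⇒ B' → A + B ⇒ A' + B'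
  f +₁ g = [ inl ∘ f , inr ∘ g ]

  ∇ : ∀ {A} → A + A ⇒ A
  ∇ = [ id , id ]

record Endofunctor {o ℓ e} (C : Category o ℓ e) : Set (o ⊔ ℓ ⊔ e) where
  open Category C
  field
    F₀ : Obj → Obj
    F₁ : ∀ {A B} → A ⇒ B → F₀ A ⇒ F₀ B
    identity : ∀ {A} → F₁ (id {A}) ≈ id
    homomorphism : ∀ {A B C} {f : A ⇒ B} {g : B ⇒ C} → F₁ (g ∘ f) ≈ F₁ g ∘ F₁ f
    F-resp-≈ : ∀ {A B} {f g : A ⇒ B} → f ≈ g → F₁ f ≈ F₁ g

record Bifunctor {o ℓ e} (C : Category o ℓ e) : Set (o ⊔ ℓ ⊔ e) where
  open Category C
  field
    F₀ : Obj → Obj → Obj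
    F₁ : ∀ {A A' B B'} → A ⇒ A' → B ⇒ B' → F₀ A B ⇒ F₀ A' B'
    identity : ∀ {A B} → F₁ (id {A}) (id {B}) ≈ id
    homomorphism : ∀ {A A' A'' B B' B''} {f : A ⇒ A'} {f' : A' ⇒ A''}
                     {g : B ⇒ B'} {g' : B' ⇒ B''} →
                   F₁ (f' ∘ f) (g' ∘ g) ≈ F₁ f' g' ∘ F₁ f g
    F-resp-≈ : ∀ {A A' B B'} {f f' : A ⇒ A'} {g g' : B ⇒ B'} →
               f ≈ f' → g ≈ g' → F₁ f g ≈ F₁ f' g'

record MixedFunctor {o ℓ e} (C : Category o ℓ e) : Set (o ⊔ ℓ ⊔ e) where
  open Category C
  field
    F₀ : Obj → Obj → Obj
    F₁ : ∀ {A A' B B'} → A' ⇒ A → B ⇒ B' → F₀ A B ⇒ F₀ A' B'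
    identity : ∀ {A B} → F₁ (id {A}) (id {B}) ≈ id
    homomorphism : ∀ {A A' A'' B B' B''} {f : A' ⇒ A} {f' : A'' ⇒ A'}
                     {g : B ⇒ B'} {g' : B' ⇒ B''} →
                   F₁ (f ∘ f') (g' ∘ g) ≈ F₁ f' g' ∘ F₁ f g
    F-resp-≈ : ∀ {A A' B B'} {f f' : A' ⇒ A} {g g' : B ⇒ B'} →
               f ≈ f' → g ≈ g' → F₁ f g ≈ F₁ f' g'

record Syntax {o ℓ e} (C : Category o ℓ e) (DC : Distributive C) : Set (o ⊔ ℓ ⊔ e) where
  open Category C
  open Distributive DC
  field
    Σv : Endofunctor C
    Σc : Bifunctor C
  module Σv = Endofunctor Σv
  module Σc = Bifunctor Σc

  Σ₀ : Obj → Obj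
  Σ₀ X = Σv.F₀ X + Σc.F₀ X X

  Σ₁ : ∀ {A B} → A ⇒ B → Σ₀ A ⇒ Σ₀ B
  Σ₁ f = Σv.F₁ f +₁ Σc.F₁ f f

  field
    Σ⋆ : Obj → Obj
    ηΣ : ∀ {X} → X ⇒ Σ⋆ X
    ι  : ∀ {X} → Σ₀ (Σ⋆ X) ⇒ Σ⋆ X
    ext : ∀ {X A} → (Σ₀ A ⇒ A) → (X ⇒ A) → Σ⋆ X ⇒ A
    ext-η : ∀ {X A} {a : Σ₀ A ⇒ A} {f : X ⇒ A} → ext a f ∘ ηΣ ≈ f
    ext-ι : ∀ {X A} {a : Σ₀ A ⇒ A} {f : X ⇒ A} → ext a f ∘ ι ≈ a ∘ Σ₁ (ext a f)
    ext-unique : ∀ {X A} {a : Σ₀ A ⇒ A} {f : X ⇒ A} {h : Σ⋆ X ⇒ A} →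
                 h ∘ ηΣ ≈ f → h ∘ ι ≈ a ∘ Σ₁ h → h ≈ ext a f

  Σ⋆₁ : ∀ {X Y} → X ⇒ Y → Σ⋆ X ⇒ Σ⋆ Y
  Σ⋆₁ f = ext ι (ηΣ ∘ f)

  μΣ : ∀ {X} → Σ⋆ (Σ⋆ X) ⇒ Σ⋆ X
  μΣ = ext ι id

  ιv : ∀ {X} → Σv.F₀ (Σ⋆ X) ⇒ Σ⋆ X
  ιv = ι ∘ inl

  -- initial algebra μΣ = Σ⋆ 0
  Init : Obj
  Init = Σ⋆ 𝟘

  Sv : Obj
  Sv = Σv.F₀ Init

  Sc : Obj
  Sc = Σc.F₀ Init Init

  ∇♯ : ∀ {X} → Σ⋆ (Σ⋆ X + Σ⋆ X) ⇒ Σ⋆ X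
  ∇♯ = μΣ ∘ Σ⋆₁ ∇

record StrongMonad {o ℓ e} (C : Category o ℓ e) (DC : Distributive C) : Set (o ⊔ ℓ ⊔ e) where
  open Category C
  open Distributive DC
  field
    T : Endofunctor C
  open Endofunctor T public using () renaming (F₀ to T₀; F₁ to T₁)
  field
    ηT : ∀ {X} → X ⇒ T₀ X
    mT : ∀ {X} → T₀ (T₀ X) ⇒ T₀ X
    ηT-natural : ∀ {X Y} (f : X ⇒ Y) → T₁ f ∘ ηT ≈ ηT ∘ f
    mT-natural : ∀ {X Y} (f : X ⇒ Y) → T₁ f ∘ mT ≈ mT ∘ T₁ (T₁ f)
    identityˡT : ∀ {X} → mT ∘ T₁ ηT ≈ id {T₀ X}
    identityʳT : ∀ {X} → mT ∘ ηT ≈ id {T₀ X}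
    assocT : ∀ {X} → mT ∘ T₁ mT ≈ mT ∘ mT {T₀ X}
    τ : ∀ {A B} → A × T₀ B ⇒ T₀ (A × B)
    τ-natural : ∀ {A A' B B'} (f : A ⇒ A') (g : B ⇒ B') →
                T₁ (f ×₁ g) ∘ τ ≈ τ ∘ (f ×₁ T₁ g)
    τ-unit : ∀ {A} → T₁ snd ∘ τ {𝟙} {A} ≈ snd
    τ-assoc : ∀ {A B C} →
      T₁ ⟨ fst ∘ fst , ⟨ snd ∘ fst , snd ⟩ ⟩ ∘ τ {A × B} {C}
        ≈ τ ∘ (id ×₁ τ) ∘ ⟨ fst ∘ fst , ⟨ snd ∘ fst , snd ⟩ ⟩
    τ-η : ∀ {A B} → τ ∘ (id ×₁ ηT) ≈ ηT {A × B}
    τ-μ : ∀ {A B} → τ ∘ (id ×₁ mT) ≈ mT ∘ T₁ τ ∘ τ {A} {T₀ B}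

record SeparatedLaw {o ℓ e} (C : Category o ℓ e) (DC : Distributive C)
                    (S : Syntax C DC) (M : StrongMonad C DC) (D : MixedFunctor C)
                    : Set (o ⊔ ℓ ⊔ e) where
  open Category C
  open Distributive DC
  open Syntax S
  open StrongMonad M
  module D = MixedFunctor D

  B₀ : Obj → Obj → Obj
  B₀ X Y = T₀ (D.F₀ X Y) + T₀ Y

  B₁ : ∀ {X X' Y Y'} → X' ⇒ X → Y ⇒ Y' → B₀ X Y ⇒ B₀ X' Y'
  B₁ f g = T₁ (D.F₁ f g) +₁ T₁ g

  field
    ρv : ∀ X → Σv.F₀ X ⇒ D.F₀ X (Σ⋆ X)
    ρv-dinatural : ∀ {X Y} (f : X ⇒ Y) →
      D.F₁ id (Σ⋆₁ f) ∘ ρv X ≈ D.F₁ f id ∘ ρv Y ∘ Σv.F₁ f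
    ρc : ∀ X Y → Σc.F₀ (X × B₀ X Y) X ⇒ T₀ (Σ⋆ (X + Y))
    ρc-dinatural : ∀ {X X'} Y (f : X ⇒ X') →
      T₁ (Σ⋆₁ (f +₁ id)) ∘ ρc X Y ∘ Σc.F₁ (id ×₁ B₁ f id) id
        ≈ ρc X' Y ∘ Σc.F₁ (f ×₁ id) f
    ρc-natural : ∀ X {Y Y'} (g : Y ⇒ Y') →
      T₁ (Σ⋆₁ (id +₁ g)) ∘ ρc X Y ≈ ρc X Y' ∘ Σc.F₁ (id ×₁ B₁ id g) id
    χ : ∀ X Y → Σc.F₀ (T₀ X) Y ⇒ T₀ (Σc.F₀ X Y)
    χ-natural : ∀ {X X' Y Y'} (f : X ⇒ X') (g : Y ⇒ Y') →
      T₁ (Σc.F₁ f g) ∘ χ X Y ≈ χ X' Y' ∘ Σc.F₁ (T₁ f) g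
    χ-η : ∀ X Y → χ X Y ∘ Σc.F₁ ηT id ≈ ηT
    χ-μ : ∀ X Y → χ X Y ∘ Σc.F₁ mT id ≈ mT ∘ T₁ (χ X Y) ∘ χ (T₀ X) Y

  ρcv : ∀ X Y → Σc.F₀ (X × T₀ (D.F₀ X Y)) X ⇒ T₀ (Σ⋆ (X + Y))
  ρcv X Y = ρc X Y ∘ Σc.F₁ (id ×₁ inl) id

  γv : Sv ⇒ T₀ (D.F₀ Init Init)
  γv = ηT ∘ D.F₁ id (μΣ {𝟘}) ∘ ρv Init

  ξ : ∀ X → Σc.F₀ (Σv.F₀ X) X ⇒ T₀ (Σ⋆ X)
  ξ X = T₁ (∇♯ {X})
      ∘ ρcv (Σ⋆ X) (Σ⋆ X)
      ∘ Σc.F₁ ⟨ ιv , ηT ∘ D.F₁ id (μΣ {X}) ∘ ρv (Σ⋆ X) ⟩ id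
      ∘ Σc.F₁ (Σv.F₁ (ηΣ {X})) (ηΣ {X})

-- Unfolding ξ at μΣ, the rule ρᶜ is applied over the free algebra Σ⋆μΣ to a pair whose
-- second component is a pure value ηᵀ ∘ D(id, μ) ∘ ρᵛ. Multiplication μ : Σ⋆μΣ → μΣ is a
-- retraction of ηΣ, so naturality of ρᶜ in its second argument together with dinaturality of
-- ρᶜ and ρᵛ in their first argument transports this application down to μΣ, where the pair
-- becomes ⟨ιᵛ, γᵛ⟩.

module Submission where

open import Defs
open import Relation.Binary using (Setoid; IsEquivalence)
import Relation.Binary.Reasoning.Setoid as SetoidReasoning

module CategoryReasoning {o ℓ e} (C : Category o ℓ e) where
  open Category C

  hom-setoid : Obj → Obj → Setoid ℓ e
  hom-setoid A B = record { Carrier = A ⇒ B ; _≈_ = _≈_ ; isEquivalence = equiv }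

  module _ {A B : Obj} where
    open IsEquivalence (equiv {A} {B}) public
      using () renaming (refl to ≈-refl; sym to ≈-sym; trans to ≈-trans)
    open SetoidReasoning (hom-setoid A B) public

  infixr 4 _⟩∘⟨_ refl⟩∘⟨_
  infixl 5 _⟩∘⟨refl

  _⟩∘⟨_ : ∀ {A B Z} {f h : B ⇒ Z} {g i : A ⇒ B} → f ≈ h → g ≈ i → f ∘ g ≈ h ∘ i
  _⟩∘⟨_ = ∘-resp-≈

  refl⟩∘⟨_ : ∀ {A B Z} {f : B ⇒ Z} {g i : A ⇒ B} → g ≈ i → f ∘ g ≈ f ∘ i
  refl⟩∘⟨ p = ≈-refl ⟩∘⟨ p

  _⟩∘⟨refl : ∀ {A B Z} {f h : B ⇒ Z} {g : A ⇒ B} → f ≈ h → f ∘ g ≈ h ∘ g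
  p ⟩∘⟨refl = p ⟩∘⟨ ≈-refl

  sym-assoc : ∀ {A B Z W} {f : A ⇒ B} {g : B ⇒ Z} {h : Z ⇒ W} → h ∘ (g ∘ f) ≈ (h ∘ g) ∘ f
  sym-assoc = ≈-sym assoc

  pullˡ : ∀ {A B Z W} {a : Z ⇒ W} {b : B ⇒ Z} {c : B ⇒ W} {f : A ⇒ B} →
          a ∘ b ≈ c → a ∘ (b ∘ f) ≈ c ∘ f
  pullˡ p = ≈-trans sym-assoc (p ⟩∘⟨refl)

  pullʳ : ∀ {A B Z W} {a : B ⇒ Z} {b : A ⇒ B} {c : A ⇒ Z} {f : Z ⇒ W} →
          a ∘ b ≈ c → (f ∘ a) ∘ b ≈ f ∘ c
  pullʳ p = ≈-trans assoc (refl⟩∘⟨ p)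

  resp-prefix₃ : ∀ {A B B' Z Z' W V} {f : W ⇒ V} {g : Z ⇒ W} {h : B ⇒ Z}
                   {f' : Z' ⇒ V} {g' : B' ⇒ Z'} {h' : B ⇒ B'} {k : A ⇒ B} →
                 f ∘ g ∘ h ≈ f' ∘ g' ∘ h' → f ∘ g ∘ h ∘ k ≈ f' ∘ g' ∘ h' ∘ k
  resp-prefix₃ p =
    ≈-trans (refl⟩∘⟨ sym-assoc) (≈-trans sym-assoc (≈-trans (p ⟩∘⟨refl) (≈-trans assoc (refl⟩∘⟨ assoc))))

module DistributiveLemmas {o ℓ e} {C : Category o ℓ e} (DC : Distributive C) where
  open Category C
  open Distributive DC
  open CategoryReasoning C

  []-cong₂ : ∀ {A B X} {f f' : A ⇒ X} {g g' : B ⇒ X} → f ≈ f' → g ≈ g' → [ f , g ] ≈ [ f' , g' ]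
  []-cong₂ p q = []-unique (≈-trans []∘inl p) (≈-trans []∘inr q)

  ∘-[] : ∀ {A B X Y} {f : X ⇒ Y} {g : A ⇒ X} {h : B ⇒ X} → f ∘ [ g , h ] ≈ [ f ∘ g , f ∘ h ]
  ∘-[] = []-unique (pullʳ []∘inl) (pullʳ []∘inr)

  []∘+₁ : ∀ {A B A' B' X} {f : A' ⇒ X} {g : B' ⇒ X} {h : A ⇒ A'} {k : B ⇒ B'} →
          [ f , g ] ∘ (h +₁ k) ≈ [ f ∘ h , g ∘ k ]
  []∘+₁ = []-unique (≈-trans (pullʳ []∘inl) (pullˡ []∘inl)) (≈-trans (pullʳ []∘inr) (pullˡ []∘inr))

  +₁∘+₁ : ∀ {A B A' B' A'' B''} {f : A' ⇒ A''} {g : B' ⇒ B''} {h : A ⇒ A'} {k : B ⇒ B'} →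
          (f +₁ g) ∘ (h +₁ k) ≈ (f ∘ h) +₁ (g ∘ k)
  +₁∘+₁ = ≈-trans []∘+₁ ([]-cong₂ assoc assoc)

  ∇∘+₁ : ∀ {A B X} {f : A ⇒ X} {g : B ⇒ X} → ∇ ∘ (f +₁ g) ≈ [ f , g ]
  ∇∘+₁ = ≈-trans []∘+₁ ([]-cong₂ identityˡ identityˡ)

  +₁-factor : ∀ {A B A' B'} {f : A ⇒ A'} {g : B ⇒ B'} → f +₁ g ≈ (f +₁ id) ∘ (id +₁ g)
  +₁-factor = ≈-sym (≈-trans +₁∘+₁ ([]-cong₂ (refl⟩∘⟨ identityʳ) (refl⟩∘⟨ identityˡ)))

  ⟨⟩∘ : ∀ {X Y A B} {f : X ⇒ A} {g : X ⇒ B} {h : Y ⇒ X} → ⟨ f , g ⟩ ∘ h ≈ ⟨ f ∘ h , g ∘ h ⟩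
  ⟨⟩∘ = ⟨⟩-unique (pullˡ fst∘⟨⟩) (pullˡ snd∘⟨⟩)

  ⟨⟩-cong₂ : ∀ {X A B} {f f' : X ⇒ A} {g g' : X ⇒ B} → f ≈ f' → g ≈ g' → ⟨ f , g ⟩ ≈ ⟨ f' , g' ⟩
  ⟨⟩-cong₂ p q = ⟨⟩-unique (≈-trans fst∘⟨⟩ p) (≈-trans snd∘⟨⟩ q)

  ×₁∘⟨⟩ : ∀ {X A B A' B'} {f : A ⇒ A'} {g : B ⇒ B'} {h : X ⇒ A} {k : X ⇒ B} →
          (f ×₁ g) ∘ ⟨ h , k ⟩ ≈ ⟨ f ∘ h , g ∘ k ⟩
  ×₁∘⟨⟩ = ≈-trans ⟨⟩∘ (⟨⟩-cong₂ (pullʳ fst∘⟨⟩) (pullʳ snd∘⟨⟩))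

module EndofunctorLemmas {o ℓ e} {C : Category o ℓ e} (F : Endofunctor C) where
  open Category C
  open Endofunctor F
  open CategoryReasoning C

  resp-∘ : ∀ {A B Z} {f : B ⇒ Z} {g : A ⇒ B} {h : A ⇒ Z} → f ∘ g ≈ h → F₁ f ∘ F₁ g ≈ F₁ h
  resp-∘ p = ≈-trans (≈-sym homomorphism) (F-resp-≈ p)

  homomorphism₃ : ∀ {A B Z W} {f : Z ⇒ W} {g : B ⇒ Z} {h : A ⇒ B} →
                  F₁ (f ∘ g ∘ h) ≈ F₁ f ∘ F₁ g ∘ F₁ h
  homomorphism₃ = ≈-trans homomorphism (refl⟩∘⟨ homomorphism)

  resp-∘₃ : ∀ {A B B' Z Z' W} {f : Z ⇒ W} {g : B ⇒ Z} {h : A ⇒ B}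
              {f' : Z' ⇒ W} {g' : B' ⇒ Z'} {h' : A ⇒ B'} →
            f ∘ g ∘ h ≈ f' ∘ g' ∘ h' → F₁ f ∘ F₁ g ∘ F₁ h ≈ F₁ f' ∘ F₁ g' ∘ F₁ h'
  resp-∘₃ p = ≈-trans (≈-sym homomorphism₃) (≈-trans (F-resp-≈ p) homomorphism₃)

  retract : ∀ {A B} {r : B ⇒ A} {s : A ⇒ B} → r ∘ s ≈ id → F₁ r ∘ F₁ s ≈ id
  retract p = ≈-trans (resp-∘ p) identity

module BifunctorLemmas {o ℓ e} {C : Category o ℓ e} (F : Bifunctor C) where
  open Category C
  open Bifunctor F
  open CategoryReasoning C

  resp-∘ : ∀ {A A' A'' B B' B''} {f : A ⇒ A'} {f' : A' ⇒ A''} {k : A ⇒ A''}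
             {g : B ⇒ B'} {g' : B' ⇒ B''} {l : B ⇒ B''} →
           f' ∘ f ≈ k → g' ∘ g ≈ l → F₁ f' g' ∘ F₁ f g ≈ F₁ k l
  resp-∘ p q = ≈-trans (≈-sym homomorphism) (F-resp-≈ p q)

module MixedFunctorLemmas {o ℓ e} {C : Category o ℓ e} (F : MixedFunctor C) where
  open Category C
  open MixedFunctor F
  open CategoryReasoning C

  resp-∘ : ∀ {A A' A'' B B' B''} {f : A' ⇒ A} {f' : A'' ⇒ A'} {k : A'' ⇒ A}
             {g : B ⇒ B'} {g' : B' ⇒ B''} {l : B ⇒ B''} →
           f ∘ f' ≈ k → g' ∘ g ≈ l → F₁ f' g' ∘ F₁ f g ≈ F₁ k l
  resp-∘ p q = ≈-trans (≈-sym homomorphism) (F-resp-≈ p q)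

  interchange : ∀ {A A' B B'} {f : A' ⇒ A} {g : B ⇒ B'} → F₁ id g ∘ F₁ f id ≈ F₁ f id ∘ F₁ id g
  interchange = ≈-trans (resp-∘ identityʳ identityʳ) (≈-sym (resp-∘ identityˡ identityˡ))

module FreeAlgebraLemmas {o ℓ e} {C : Category o ℓ e} {DC : Distributive C} (S : Syntax C DC) where
  open Category C
  open Distributive DC
  open Syntax S
  open CategoryReasoning C
  open DistributiveLemmas DC

  IsHom : ∀ {Z W} → Σ⋆ Z ⇒ Σ⋆ W → Set e
  IsHom h = h ∘ ι ≈ ι ∘ Σ₁ h

  Σ₁-homomorphism : ∀ {A B Z} {f : A ⇒ B} {g : B ⇒ Z} → Σ₁ (g ∘ f) ≈ Σ₁ g ∘ Σ₁ f
  Σ₁-homomorphism =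
    ≈-trans ([]-cong₂ (refl⟩∘⟨ Σv.homomorphism) (refl⟩∘⟨ Σc.homomorphism)) (≈-sym +₁∘+₁)

  ∘-isHom : ∀ {Z W V} {h : Σ⋆ W ⇒ Σ⋆ V} {g : Σ⋆ Z ⇒ Σ⋆ W} → IsHom h → IsHom g → IsHom (h ∘ g)
  ∘-isHom {h = h} {g} hom-h hom-g = begin
    (h ∘ g) ∘ ι        ≈⟨ pullʳ hom-g ⟩
    h ∘ ι ∘ Σ₁ g       ≈⟨ pullˡ hom-h ⟩
    (ι ∘ Σ₁ h) ∘ Σ₁ g  ≈⟨ pullʳ (≈-sym Σ₁-homomorphism) ⟩
    ι ∘ Σ₁ (h ∘ g)     ∎

  isHom-unique : ∀ {Z W} {h₁ h₂ : Σ⋆ Z ⇒ Σ⋆ W} →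
                 IsHom h₁ → IsHom h₂ → h₁ ∘ ηΣ ≈ h₂ ∘ ηΣ → h₁ ≈ h₂
  isHom-unique hom₁ hom₂ p = ≈-trans (ext-unique p hom₁) (≈-sym (ext-unique ≈-refl hom₂))

  ∇♯-isHom : ∀ {X} → IsHom (∇♯ {X})
  ∇♯-isHom = ∘-isHom ext-ι ext-ι

  isHom-ιv : ∀ {Z W} {h : Σ⋆ Z ⇒ Σ⋆ W} → IsHom h → h ∘ ιv ≈ ιv ∘ Σv.F₁ h
  isHom-ιv hom-h = ≈-trans (pullˡ hom-h) (≈-trans (pullʳ []∘inl) sym-assoc)

  Σ⋆₁-η : ∀ {X Y} {f : X ⇒ Y} → Σ⋆₁ f ∘ ηΣ ≈ ηΣ ∘ f
  Σ⋆₁-η = ext-η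

  ∘Σ⋆₁-η : ∀ {X Y Z} {h : Σ⋆ Y ⇒ Z} {f : X ⇒ Y} → (h ∘ Σ⋆₁ f) ∘ ηΣ ≈ (h ∘ ηΣ) ∘ f
  ∘Σ⋆₁-η = ≈-trans (pullʳ Σ⋆₁-η) sym-assoc

  ∇♯∘Σ⋆₁-η : ∀ {X Y} {f : Y ⇒ Σ⋆ X + Σ⋆ X} → (∇♯ ∘ Σ⋆₁ f) ∘ ηΣ ≈ ∇ ∘ f
  ∇♯∘Σ⋆₁-η = ≈-trans ∘Σ⋆₁-η (≈-trans ∘Σ⋆₁-η (≈-trans (ext-η ⟩∘⟨refl) identityˡ) ⟩∘⟨refl)

  Σ⋆₁-resp-≈ : ∀ {X Y} {f g : X ⇒ Y} → f ≈ g → Σ⋆₁ f ≈ Σ⋆₁ g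
  Σ⋆₁-resp-≈ p = ext-unique (≈-trans ext-η (refl⟩∘⟨ p)) ext-ι

  Σ⋆₁-homomorphism : ∀ {X Y Z} {f : X ⇒ Y} {g : Y ⇒ Z} → Σ⋆₁ (g ∘ f) ≈ Σ⋆₁ g ∘ Σ⋆₁ f
  Σ⋆₁-homomorphism {f = f} {g} = isHom-unique ext-ι (∘-isHom ext-ι ext-ι) (begin
    Σ⋆₁ (g ∘ f) ∘ ηΣ        ≈⟨ Σ⋆₁-η ⟩
    ηΣ ∘ g ∘ f             ≈⟨ ≈-trans (pullˡ Σ⋆₁-η) assoc ⟨
    Σ⋆₁ g ∘ ηΣ ∘ f         ≈⟨ refl⟩∘⟨ Σ⋆₁-η ⟨
    Σ⋆₁ g ∘ Σ⋆₁ f ∘ ηΣ     ≈⟨ sym-assoc ⟩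
    (Σ⋆₁ g ∘ Σ⋆₁ f) ∘ ηΣ   ∎)

  μΣ-assoc : ∀ {X} → μΣ {X} ∘ μΣ ≈ μΣ ∘ Σ⋆₁ μΣ
  μΣ-assoc = isHom-unique (∘-isHom ext-ι ext-ι) (∘-isHom ext-ι ext-ι) (begin
    (μΣ ∘ μΣ) ∘ ηΣ       ≈⟨ pullʳ ext-η ⟩
    μΣ ∘ id              ≈⟨ identityʳ ⟩
    μΣ                   ≈⟨ identityˡ ⟨
    id ∘ μΣ              ≈⟨ ext-η ⟩∘⟨refl ⟨
    (μΣ ∘ ηΣ) ∘ μΣ       ≈⟨ ∘Σ⋆₁-η ⟨
    (μΣ ∘ Σ⋆₁ μΣ) ∘ ηΣ   ∎)

  μΣ∘ιv∘Σvη : ∀ {X} → μΣ ∘ ιv ∘ Σv.F₁ ηΣ ≈ ιv {X}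
  μΣ∘ιv∘Σvη = ≈-trans (pullˡ (isHom-ιv ext-ι))
                (≈-trans (pullʳ (EndofunctorLemmas.retract Σv ext-η)) identityʳ)

  μΣ∘∇♯ : ∀ {X} → μΣ {X} ∘ ∇♯ ∘ Σ⋆₁ (id +₁ μΣ {Σ⋆ X})
                 ≈ ∇♯ {X} ∘ Σ⋆₁ (μΣ +₁ id) ∘ Σ⋆₁ (id +₁ μΣ ∘ Σ⋆₁ μΣ)
  μΣ∘∇♯ {X} = begin
    μΣ ∘ ∇♯ ∘ Σ⋆₁ (id +₁ μΣ)
      ≈⟨ isHom-unique (∘-isHom ext-ι (∘-isHom ∇♯-isHom ext-ι)) (∘-isHom ∇♯-isHom ext-ι) on-η ⟩
    ∇♯ ∘ Σ⋆₁ (μΣ +₁ μΣ ∘ Σ⋆₁ μΣ)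
      ≈⟨ refl⟩∘⟨ ≈-trans (Σ⋆₁-resp-≈ +₁-factor) Σ⋆₁-homomorphism ⟩
    ∇♯ ∘ Σ⋆₁ (μΣ +₁ id) ∘ Σ⋆₁ (id +₁ μΣ ∘ Σ⋆₁ μΣ) ∎
    where
    on-η : (μΣ ∘ ∇♯ ∘ Σ⋆₁ (id +₁ μΣ)) ∘ ηΣ ≈ (∇♯ ∘ Σ⋆₁ (μΣ +₁ μΣ ∘ Σ⋆₁ μΣ)) ∘ ηΣ
    on-η = begin
      (μΣ ∘ ∇♯ ∘ Σ⋆₁ (id +₁ μΣ)) ∘ ηΣ      ≈⟨ pullʳ (≈-trans ∇♯∘Σ⋆₁-η ∇∘+₁) ⟩
      μΣ ∘ [ id , μΣ ]                     ≈⟨ ∘-[] ⟩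
      [ μΣ ∘ id , μΣ ∘ μΣ ]                ≈⟨ []-cong₂ identityʳ μΣ-assoc ⟩
      [ μΣ , μΣ ∘ Σ⋆₁ μΣ ]                 ≈⟨ ≈-trans ∇♯∘Σ⋆₁-η ∇∘+₁ ⟨
      (∇♯ ∘ Σ⋆₁ (μΣ +₁ μΣ ∘ Σ⋆₁ μΣ)) ∘ ηΣ  ∎

module SeparatedLawLemmas {o ℓ e} {C : Category o ℓ e} {DC : Distributive C} {S : Syntax C DC}
    {M : StrongMonad C DC} {D : MixedFunctor C} (L : SeparatedLaw C DC S M D) where
  open Category C
  open Distributive DC
  open Syntax S
  open StrongMonad M
  open SeparatedLaw L
  open CategoryReasoning C
  open DistributiveLemmas DC
  open BifunctorLemmas Σc using () renaming (resp-∘ to Σc-resp-∘)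
  open MixedFunctorLemmas D using () renaming (resp-∘ to D-resp-∘; interchange to D-interchange)

  ⟨_,η_⟩ : ∀ {W Z X Y} → W ⇒ Z → W ⇒ D.F₀ X Y → W ⇒ Z × B₀ X Y
  ⟨ a ,η h ⟩ = ⟨ a , inl ∘ ηT ∘ h ⟩

  ⟨,η⟩-cong₂ : ∀ {W Z X Y} {a a' : W ⇒ Z} {h h' : W ⇒ D.F₀ X Y} →
               a ≈ a' → h ≈ h' → ⟨ a ,η h ⟩ ≈ ⟨ a' ,η h' ⟩
  ⟨,η⟩-cong₂ p q = ⟨⟩-cong₂ p (refl⟩∘⟨ refl⟩∘⟨ q)

  ⟨,η⟩∘ : ∀ {V W Z X Y} {a : W ⇒ Z} {h : W ⇒ D.F₀ X Y} {s : V ⇒ W} →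
          ⟨ a ,η h ⟩ ∘ s ≈ ⟨ a ∘ s ,η h ∘ s ⟩
  ⟨,η⟩∘ = ≈-trans ⟨⟩∘ (⟨⟩-cong₂ ≈-refl (≈-trans assoc (refl⟩∘⟨ assoc)))

  id×inl∘⟨,ηT∘⟩ : ∀ {W Z X Y} {a : W ⇒ Z} {h : W ⇒ D.F₀ X Y} →
                  (id ×₁ inl) ∘ ⟨ a , ηT ∘ h ⟩ ≈ ⟨ a ,η h ⟩
  id×inl∘⟨,ηT∘⟩ = ≈-trans ×₁∘⟨⟩ (⟨⟩-cong₂ identityˡ ≈-refl)

  f×id∘⟨,η⟩ : ∀ {W Z Z' X Y} {f : Z ⇒ Z'} {a : W ⇒ Z} {h : W ⇒ D.F₀ X Y} →
              (f ×₁ id) ∘ ⟨ a ,η h ⟩ ≈ ⟨ f ∘ a ,η h ⟩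
  f×id∘⟨,η⟩ = ≈-trans ×₁∘⟨⟩ (⟨⟩-cong₂ ≈-refl identityˡ)

  id×B₁∘⟨,η⟩ : ∀ {W Z X X' Y Y'} {f : X' ⇒ X} {g : Y ⇒ Y'} {a : W ⇒ Z} {h : W ⇒ D.F₀ X Y} →
               (id ×₁ B₁ f g) ∘ ⟨ a ,η h ⟩ ≈ ⟨ a ,η D.F₁ f g ∘ h ⟩
  id×B₁∘⟨,η⟩ {f = f} {g} {h = h} = ≈-trans ×₁∘⟨⟩ (⟨⟩-cong₂ identityˡ (begin
    B₁ f g ∘ inl ∘ ηT ∘ h               ≈⟨ pullˡ []∘inl ⟩
    (inl ∘ T₁ (D.F₁ f g)) ∘ ηT ∘ h      ≈⟨ pullʳ (≈-trans (pullˡ (ηT-natural _)) assoc) ⟩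
    inl ∘ ηT ∘ D.F₁ f g ∘ h             ∎))

  ρcv-⟨,η⟩ : ∀ {V W X Y} {a : W ⇒ X} {h : W ⇒ D.F₀ X Y} {b : V ⇒ X} →
             ρcv X Y ∘ Σc.F₁ ⟨ a , ηT ∘ h ⟩ b ≈ ρc X Y ∘ Σc.F₁ ⟨ a ,η h ⟩ b
  ρcv-⟨,η⟩ = pullʳ (Σc-resp-∘ id×inl∘⟨,ηT∘⟩ identityˡ)

  ξ-⟨,η⟩ : ∀ {X} → ξ X ≈ T₁ ∇♯ ∘ ρc (Σ⋆ X) (Σ⋆ X)
                         ∘ Σc.F₁ ⟨ ιv ∘ Σv.F₁ ηΣ ,η D.F₁ id μΣ ∘ ρv (Σ⋆ X) ∘ Σv.F₁ ηΣ ⟩ ηΣ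
  ξ-⟨,η⟩ = refl⟩∘⟨ ≈-trans (pullˡ ρcv-⟨,η⟩)
             (pullʳ (Σc-resp-∘ (≈-trans ⟨,η⟩∘ (⟨,η⟩-cong₂ ≈-refl assoc)) identityˡ))

  ρc-natural-⟨,η⟩ : ∀ {V W X Y Y'} (g : Y ⇒ Y') {a : W ⇒ X} {h : W ⇒ D.F₀ X Y} {b : V ⇒ X} →
                    T₁ (Σ⋆₁ (id +₁ g)) ∘ ρc X Y ∘ Σc.F₁ ⟨ a ,η h ⟩ b
                      ≈ ρc X Y' ∘ Σc.F₁ ⟨ a ,η D.F₁ id g ∘ h ⟩ b
  ρc-natural-⟨,η⟩ {X = X} g =
    ≈-trans (pullˡ (ρc-natural X g)) (pullʳ (Σc-resp-∘ id×B₁∘⟨,η⟩ identityˡ))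

  ρc-dinatural-⟨,η⟩ : ∀ {V W X X' Y} (f : X ⇒ X') {a : W ⇒ X} {h : W ⇒ D.F₀ X' Y} {b : V ⇒ X} →
                      T₁ (Σ⋆₁ (f +₁ id)) ∘ ρc X Y ∘ Σc.F₁ ⟨ a ,η D.F₁ f id ∘ h ⟩ b
                        ≈ ρc X' Y ∘ Σc.F₁ ⟨ f ∘ a ,η h ⟩ (f ∘ b)
  ρc-dinatural-⟨,η⟩ {X = X} {X'} {Y} f {a} {h} {b} = begin
    T₁ (Σ⋆₁ (f +₁ id)) ∘ ρc X Y ∘ Σc.F₁ ⟨ a ,η D.F₁ f id ∘ h ⟩ b
      ≈⟨ refl⟩∘⟨ refl⟩∘⟨ Σc-resp-∘ id×B₁∘⟨,η⟩ identityˡ ⟨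
    T₁ (Σ⋆₁ (f +₁ id)) ∘ ρc X Y ∘ Σc.F₁ (id ×₁ B₁ f id) id ∘ Σc.F₁ ⟨ a ,η h ⟩ b
      ≈⟨ ≈-trans (refl⟩∘⟨ sym-assoc) sym-assoc ⟩
    (T₁ (Σ⋆₁ (f +₁ id)) ∘ ρc X Y ∘ Σc.F₁ (id ×₁ B₁ f id) id) ∘ Σc.F₁ ⟨ a ,η h ⟩ b
      ≈⟨ ρc-dinatural Y f ⟩∘⟨refl ⟩
    (ρc X' Y ∘ Σc.F₁ (f ×₁ id) f) ∘ Σc.F₁ ⟨ a ,η h ⟩ b
      ≈⟨ pullʳ (Σc-resp-∘ f×id∘⟨,η⟩ ≈-refl) ⟩
    ρc X' Y ∘ Σc.F₁ ⟨ f ∘ a ,η h ⟩ (f ∘ b) ∎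

  ρv-dinatural-retract : ∀ {X Y Z} {f : X ⇒ Y} {s : Y ⇒ X} (g : Σ⋆ Y ⇒ Z) → f ∘ s ≈ id →
                         D.F₁ id (g ∘ Σ⋆₁ f) ∘ ρv X ∘ Σv.F₁ s ≈ D.F₁ f id ∘ D.F₁ id g ∘ ρv Y
  ρv-dinatural-retract {X} {Y} {f = f} {s} g f∘s≈id = begin
    D.F₁ id (g ∘ Σ⋆₁ f) ∘ ρv X ∘ Σv.F₁ s
      ≈⟨ D-resp-∘ identityˡ ≈-refl ⟩∘⟨refl ⟨
    (D.F₁ id g ∘ D.F₁ id (Σ⋆₁ f)) ∘ ρv X ∘ Σv.F₁ s
      ≈⟨ pullʳ (pullˡ (ρv-dinatural f)) ⟩
    D.F₁ id g ∘ (D.F₁ f id ∘ ρv Y ∘ Σv.F₁ f) ∘ Σv.F₁ s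
      ≈⟨ refl⟩∘⟨ pullʳ (≈-trans (pullʳ (EndofunctorLemmas.retract Σv f∘s≈id)) identityʳ) ⟩
    D.F₁ id g ∘ D.F₁ f id ∘ ρv Y
      ≈⟨ ≈-trans (pullˡ D-interchange) assoc ⟩
    D.F₁ f id ∘ D.F₁ id g ∘ ρv Y ∎

lemma4p2 : ∀ {o ℓ e} (C : Category o ℓ e) (DC : Distributive C) (S : Syntax C DC)
             (M : StrongMonad C DC) (D : MixedFunctor C) (L : SeparatedLaw C DC S M D) →
           let open Category C
               open Distributive DC
               open Syntax S
               open StrongMonad M
               open SeparatedLaw L
           in T₁ (μΣ {𝟘}) ∘ ξ Init
                ≈ T₁ (∇♯ {𝟘}) ∘ ρcv Init Init ∘ Σc.F₁ ⟨ ιv {𝟘} , γv ⟩ id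
lemma4p2 C DC S M D L = begin
  T₁ μ₀ ∘ ξ Init
    ≈⟨ refl⟩∘⟨ ξ-⟨,η⟩ ⟩
  T₁ μ₀ ∘ T₁ ∇♯ ∘ ρc _ _ ∘ Σc.F₁ ⟨ a₀ ,η D.F₁ id μ₁ ∘ k₀ ⟩ ηΣ
    ≈⟨ refl⟩∘⟨ refl⟩∘⟨ ρc-natural-⟨,η⟩ μ₁ ⟨
  T₁ μ₀ ∘ T₁ ∇♯ ∘ T₁ (Σ⋆₁ (id +₁ μ₁)) ∘ ρc _ _ ∘ Σc.F₁ ⟨ a₀ ,η k₀ ⟩ ηΣ
    ≈⟨ resp-prefix₃ (T-resp-∘₃ μΣ∘∇♯) ⟩
  T₁ ∇♯ ∘ T₁ (Σ⋆₁ (μ₀ +₁ id)) ∘ T₁ (Σ⋆₁ (id +₁ μ₀ ∘ Σ⋆₁ μ₀)) ∘ ρc _ _ ∘ Σc.F₁ ⟨ a₀ ,η k₀ ⟩ ηΣ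
    ≈⟨ refl⟩∘⟨ refl⟩∘⟨ ρc-natural-⟨,η⟩ (μ₀ ∘ Σ⋆₁ μ₀) ⟩
  T₁ ∇♯ ∘ T₁ (Σ⋆₁ (μ₀ +₁ id)) ∘ ρc _ _ ∘ Σc.F₁ ⟨ a₀ ,η D.F₁ id (μ₀ ∘ Σ⋆₁ μ₀) ∘ k₀ ⟩ ηΣ
    ≈⟨ refl⟩∘⟨ refl⟩∘⟨ refl⟩∘⟨ Σc.F-resp-≈ (⟨,η⟩-cong₂ ≈-refl (ρv-dinatural-retract μ₀ ext-η)) ≈-refl ⟩
  T₁ ∇♯ ∘ T₁ (Σ⋆₁ (μ₀ +₁ id)) ∘ ρc _ _ ∘ Σc.F₁ ⟨ a₀ ,η D.F₁ μ₀ id ∘ D.F₁ id μ₀ ∘ ρv Init ⟩ ηΣ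
    ≈⟨ refl⟩∘⟨ ρc-dinatural-⟨,η⟩ μ₀ ⟩
  T₁ ∇♯ ∘ ρc Init Init ∘ Σc.F₁ ⟨ μ₀ ∘ a₀ ,η D.F₁ id μ₀ ∘ ρv Init ⟩ (μ₀ ∘ ηΣ)
    ≈⟨ refl⟩∘⟨ refl⟩∘⟨ Σc.F-resp-≈ (⟨,η⟩-cong₂ μΣ∘ιv∘Σvη ≈-refl) ext-η ⟩
  T₁ ∇♯ ∘ ρc Init Init ∘ Σc.F₁ ⟨ ιv ,η D.F₁ id μ₀ ∘ ρv Init ⟩ id
    ≈⟨ refl⟩∘⟨ ρcv-⟨,η⟩ ⟨
  T₁ ∇♯ ∘ ρcv Init Init ∘ Σc.F₁ ⟨ ιv , γv ⟩ id ∎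
  where
  open Category C
  open Distributive DC
  open Syntax S
  open StrongMonad M
  open SeparatedLaw L
  open CategoryReasoning C
  open EndofunctorLemmas T using () renaming (resp-∘₃ to T-resp-∘₃)
  open FreeAlgebraLemmas S
  open SeparatedLawLemmas L

  μ₀ : Σ⋆ Init ⇒ Init
  μ₀ = μΣ

  μ₁ : Σ⋆ (Σ⋆ Init) ⇒ Σ⋆ Init
  μ₁ = μΣ

  a₀ : Sv ⇒ Σ⋆ Init
  a₀ = ιv ∘ Σv.F₁ ηΣ

  k₀ : Sv ⇒ D.F₀ (Σ⋆ Init) (Σ⋆ (Σ⋆ Init))
  k₀ = ρv (Σ⋆ Init) ∘ Σv.F₁ ηΣ
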